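{- Let $G=(V,E)$ be a graph, let $\mathcal{F}$ be a disjointness-compliable family of subsets of $V$ all of whose cores are singletons, with terminal set $T$, and let $J\subseteq E$ be an inclusion-minimal edge set covering $\mathcal{F}$. Let $H=(V_H,E_H)$ be a connected component of $(V,J)$ with at least one edge (so $H$ is a tree). Then: (i) $V_H$ contains at least one terminal; (ii) if $V_H$ contains exactly one terminal $t$, then $E_H$ is a restricted $\mathcal{F}(\{t\})$-cover; (iii) if $\mathcal{F}$ is proper, then every leaf of $H$ is a terminal, and thus $V_H$ contains at least two terminals.
   Context: An edge covers $A\subset V$ if it has exactly one end in $A$; an edge set covers $A$ if one of its edges does, and covers $\mathcal{F}$ if it covers every member. $\mathcal{F}$ is disjointness-compliable if $A'\subseteq A\in\mathcal{F}$ implies $A'\in\mathcal{F}$ or $A\setminus A'\in\mathcal{F}$; proper if additionally $A\in\mathcal{F}$ implies $V\setminus A\in\mathcal{F}$. An $\mathcal{F}$-core is an inclusion-minimal member of $\mathcal{F}$; when all cores are singletons, a terminal is a node $t$ with $\{t\}$ a core and $T$ is the set of terminals. The halo-family $\mathcal{F}(\{t\})$ is the family of $A\in\mathcal{F}$ with $A\cap T=\{t\}$. A restricted $\mathcal{F}(\{t\})$-cover is an edge set covering $\mathcal{F}(\{t\})$ none of whose edges has an end in $T\setminus\{t\}$. -}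

module Defs where

-- Conventions:
--  * The graph G = (V , E) is finite: V = Fin n, E = Fin m (edge names), with
--    'ends : Fin m → Fin n × Fin n' giving the two ends of each edge
--    (parallel edges / loops are permitted; this only makes the result more general).
--  * An edge set J ⊆ E is a 'Subset m'.
--  * A family 𝓕 of subsets of V is a Boolean-valued predicate 'Subset n → Bool'
--    (a finite family of subsets of the finite set V); A ∈ 𝓕 means 𝓕 A ≡ true.

open import Data.Nat using (ℕ)
open import Data.Bool using (Bool; true; false)
open import Data.Fin using (Fin)
open import Data.Fin.Subset using (Subset; _∈_; _∉_; _⊆_; ⁅_⁆; ∁; _─_)
open import Data.Product using (Σ; ∃; ∃-syntax; _×_; _,_; proj₁; proj₂)
open import Data.Sum using (_⊎_)
open import Relation.Binary.PropositionalEquality using (_≡_)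
open import Relation.Nullary using (¬_)

module _ {n : ℕ} where

  Family : Set
  Family = Subset n → Bool

  _∈𝓕_ : Subset n → Family → Set
  A ∈𝓕 𝓕 = 𝓕 A ≡ true

  DisjointnessCompliable : Family → Set
  DisjointnessCompliable 𝓕 =
    ∀ (A' A : Subset n) → A' ⊆ A → A ∈𝓕 𝓕 → (A' ∈𝓕 𝓕) ⊎ ((A ─ A') ∈𝓕 𝓕)

  Proper : Family → Set
  Proper 𝓕 = DisjointnessCompliable 𝓕 × (∀ (A : Subset n) → A ∈𝓕 𝓕 → ∁ A ∈𝓕 𝓕)

  Core : Family → Subset n → Set
  Core 𝓕 A = A ∈𝓕 𝓕 × (∀ (B : Subset n) → B ∈𝓕 𝓕 → B ⊆ A → B ≡ A)

  CoresSingletons : Family → Set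
  CoresSingletons 𝓕 = ∀ (A : Subset n) → Core 𝓕 A → ∃[ v ] A ≡ ⁅ v ⁆

  Terminal : Family → Fin n → Set
  Terminal 𝓕 t = Core 𝓕 ⁅ t ⁆

  -- A belongs to the halo-family 𝓕({t}):  A ∈ 𝓕 and A ∩ T = {t}
  InHalo : Family → Fin n → Subset n → Set
  InHalo 𝓕 t A = A ∈𝓕 𝓕 × t ∈ A × (∀ (s : Fin n) → Terminal 𝓕 s → s ∈ A → s ≡ t)

module _ {n m : ℕ} (ends : Fin m → Fin n × Fin n) where

  IsEnd : Fin n → Fin m → Set
  IsEnd v e = (proj₁ (ends e) ≡ v) ⊎ (proj₂ (ends e) ≡ v)

  EdgeCovers : Fin m → Subset n → Set
  EdgeCovers e A =
    (proj₁ (ends e) ∈ A × proj₂ (ends e) ∉ A) ⊎ (proj₁ (ends e) ∉ A × proj₂ (ends e) ∈ A)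

  CoversSet : (Fin m → Set) → Subset n → Set
  CoversSet S A = ∃[ e ] (S e × EdgeCovers e A)

  CoversFamily : (Fin m → Set) → Family → Set
  CoversFamily S 𝓕 = ∀ (A : Subset n) → A ∈𝓕 𝓕 → CoversSet S A

  MinimalCover : Family → Subset m → Set
  MinimalCover 𝓕 J =
    CoversFamily (_∈ J) 𝓕 ×
    (∀ (J' : Subset m) → J' ⊆ J → CoversFamily (_∈ J') 𝓕 → J' ≡ J)

  data Reach (J : Subset m) (u : Fin n) : Fin n → Set where
    here : Reach J u u
    step : ∀ {v w} (e : Fin m) → Reach J u v → e ∈ J → IsEnd v e → IsEnd w e → Reach J u w

  CompVertex : Subset m → Fin n → Fin n → Set
  CompVertex J r v = Reach J r v

  CompEdge : Subset m → Fin n → Fin m → Set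
  CompEdge J r e = e ∈ J × Reach J r (proj₁ (ends e)) × Reach J r (proj₂ (ends e))

  CompHasEdge : Subset m → Fin n → Set
  CompHasEdge J r = ∃[ e ] CompEdge J r e

  IsLeaf : Subset m → Fin n → Fin n → Set
  IsLeaf J r v =
    CompVertex J r v ×
    ∃[ e ] (CompEdge J r e × IsEnd v e × (∀ (e' : Fin m) → CompEdge J r e' → IsEnd v e' → e' ≡ e))

  RestrictedHaloCover : Family → Fin n → (Fin m → Set) → Set
  RestrictedHaloCover 𝓕 t S =
    (∀ (A : Subset n) → InHalo 𝓕 t A → CoversSet S A) ×
    (∀ (e : Fin m) → S e → ∀ (x : Fin n) → IsEnd x e → Terminal 𝓕 x → x ≡ t)

{-# OPTIONS --safe #-}
module Submission where

-- By minimality of J, every e ∈ J has a witness A ∈ 𝓕 that no other J-edge covers.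
-- No J-edge leaves the vertex set C of H, so if e lies in H then A ∩ C ∈ 𝓕: otherwise
-- A ∖ C ∈ 𝓕, and a J-edge covering it lies outside C and covers A, so it would be e.
-- A ∩ C contains a terminal, which gives (i); doing the same for A and ∁ A (𝓕 proper)
-- gives two distinct terminals. For (ii), the halo condition makes A ∖ C terminal-free,
-- so A ∩ C ∈ 𝓕 and the J-edge covering it lies in H and covers A. For a leaf v with edge
-- e, take a witness A of e containing v: no J-edge covers A - v, hence {v} ∈ 𝓕, and it is
-- a core because every member of 𝓕 is covered and so nonempty.

open import Defs
open import Data.Nat using (ℕ)
open import Data.Bool using (true)
import Data.Bool.Properties as Bool
open import Data.Fin using (Fin; _≟_)
open import Data.Fin.Properties using (any?)
open import Data.Fin.Subset
open import Data.Fin.Subset.Properties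
open import Data.Vec.Base using (_∷_; here; there)
open import Data.Fin.Subset.Induction using (Acc; acc; ⊂-wellFounded; ⊃-wellFounded)
open import Data.Product using (∃₂; ∃-syntax; _×_; _,_; proj₁; proj₂)
open import Data.Sum using (_⊎_; inj₁; inj₂)
open import Function using (_∘_; _⇔_; mk⇔; Equivalence)
open import Relation.Binary.PropositionalEquality using (_≡_; _≢_; refl; sym; trans; subst)
open import Relation.Nullary using (¬_; Dec; yes; no; contradiction)
open import Relation.Nullary.Decidable using (_×-dec_; _⊎-dec_; ¬?; decidable-stable)
open import Relation.Unary using (Decidable)

private
  variable
    n m : ℕ
    x y v : Fin n
    p q : Subset n

x∈p─q⇒x∉q : ∀ (p q : Subset n) → x ∈ p ─ q → x ∉ q
x∈p─q⇒x∉q (_ ∷ p) (outside ∷ q) here = λ ()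
x∈p─q⇒x∉q (_ ∷ p) (_ ∷ q) (there x∈p─q) (there x∈q) = x∈p─q⇒x∉q p q x∈p─q x∈q

x∉p-x : x ∉ p - x
x∉p-x {x = x} {p = p} x∈p-x = x∈p─q⇒x∉q p ⁅ x ⁆ x∈p-x (x∈⁅x⁆ x)

x∈q⇒x∉p─p∩q : x ∈ q → x ∉ p ─ (p ∩ q)
x∈q⇒x∉p─p∩q {q = q} {p = p} x∈q x∈p─p∩q =
  x∈p─q⇒x∉q p (p ∩ q) x∈p─p∩q (x∈p∩q⁺ (p─q⊆p p (p ∩ q) x∈p─p∩q , x∈q))

x∈q⇒[x∈p∩q⇔x∈p] : x ∈ q → (x ∈ p ∩ q ⇔ x ∈ p)
x∈q⇒[x∈p∩q⇔x∈p] {q = q} {p = p} x∈q = mk⇔ (p∩q⊆p p q) (λ x∈p → x∈p∩q⁺ (x∈p , x∈q))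

x∉q⇒[x∈p─p∩q⇔x∈p] : x ∉ q → (x ∈ p ─ (p ∩ q) ⇔ x ∈ p)
x∉q⇒[x∈p─p∩q⇔x∈p] {q = q} {p = p} x∉q =
  mk⇔ (p─q⊆p p (p ∩ q)) (λ x∈p → x∈p∧x∉q⇒x∈p─q x∈p (x∉q ∘ p∩q⊆q p q))

x≢y⇒[x∈p-y⇔x∈p] : x ≢ y → (x ∈ p - y ⇔ x ∈ p)
x≢y⇒[x∈p-y⇔x∈p] {y = y} {p = p} x≢y = mk⇔ (p─q⊆p p ⁅ y ⁆) (λ x∈p → x∈p∧x≢y⇒x∈p-y x∈p x≢y)

p⊆q∧p⊄q⇒p≡q : p ⊆ q → p ⊄ q → p ≡ q
p⊆q∧p⊄q⇒p≡q {p = p} p⊆q p⊄q =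
  ⊆-antisym p⊆q λ {x} x∈q → decidable-stable (x ∈? p) λ x∉p → p⊄q (p⊆q , x , x∈q , x∉p)

nonempty∧p⊆⁅x⁆⇒p≡⁅x⁆ : Nonempty p → p ⊆ ⁅ x ⁆ → p ≡ ⁅ x ⁆
nonempty∧p⊆⁅x⁆⇒p≡⁅x⁆ {p = p} {x = x} (y , y∈p) p⊆⁅x⁆ = ⊆-antisym p⊆⁅x⁆ λ z∈⁅x⁆ →
  subst (_∈ p) (trans (x∈⁅y⁆⇒x≡y x (p⊆⁅x⁆ y∈p)) (sym (x∈⁅y⁆⇒x≡y x z∈⁅x⁆))) y∈p

x∈p⇒⁅x⁆⊆p : x ∈ p → ⁅ x ⁆ ⊆ p
x∈p⇒⁅x⁆⊆p {x = x} {p = p} x∈p y∈⁅x⁆ = subst (_∈ p) (sym (x∈⁅y⁆⇒x≡y x y∈⁅x⁆)) x∈p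

module _ (𝓕 : Family {n}) where

  _∈𝓕? : Decidable (_∈𝓕 𝓕)
  A ∈𝓕? = 𝓕 A Bool.≟ true

  core⊆ : ∀ {A} → A ∈𝓕 𝓕 → ∃[ B ] (Core 𝓕 B × B ⊆ A)
  core⊆ {A} = go (⊂-wellFounded A)
    where
    go : ∀ {A} → Acc _⊂_ A → A ∈𝓕 𝓕 → ∃[ B ] (Core 𝓕 B × B ⊆ A)
    go {A} (acc rec) A∈𝓕 with anySubset? (λ B → B ∈𝓕? ×-dec B ⊂? A)
    ... | no ∄B = A , (A∈𝓕 , λ B B∈𝓕 B⊆A → p⊆q∧p⊄q⇒p≡q B⊆A (λ B⊂A → ∄B (B , B∈𝓕 , B⊂A))) , ⊆-refl
    ... | yes (B , B∈𝓕 , B⊂A@(B⊆A , _)) with go (rec B⊂A) B∈𝓕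
    ...   | C , C-core , C⊆B = C , C-core , ⊆-trans C⊆B B⊆A

  terminal∈ : CoresSingletons 𝓕 → ∀ {A} → A ∈𝓕 𝓕 → ∃[ t ] (Terminal 𝓕 t × t ∈ A)
  terminal∈ cs A∈𝓕 with core⊆ A∈𝓕
  ... | B , B-core , B⊆A with cs B B-core
  ... | t , refl = t , B-core , B⊆A (x∈⁅x⁆ t)

  singleton⇒terminal : (∀ {B} → B ∈𝓕 𝓕 → Nonempty B) → ⁅ v ⁆ ∈𝓕 𝓕 → Terminal 𝓕 v
  singleton⇒terminal nonempty v∈𝓕 = v∈𝓕 , λ B B∈𝓕 B⊆⁅v⁆ → nonempty∧p⊆⁅x⁆⇒p≡⁅x⁆ (nonempty B∈𝓕) B⊆⁅v⁆

module _ (ends : Fin m → Fin n × Fin n) where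

  Separates : Fin n → Fin n → Subset n → Set
  Separates a b A = a ∈ A × b ∉ A

  BothEnds : (Fin n → Set) → Fin m → Set
  BothEnds P e = P (proj₁ (ends e)) × P (proj₂ (ends e))

  isEnd? : ∀ v e → Dec (IsEnd ends v e)
  isEnd? v e = (proj₁ (ends e) ≟ v) ⊎-dec (proj₂ (ends e) ≟ v)

  covers? : ∀ e A → Dec (EdgeCovers ends e A)
  covers? e A = (a ∈? A ×-dec ¬? (b ∈? A)) ⊎-dec (¬? (a ∈? A) ×-dec b ∈? A)
    where
    a = proj₁ (ends e)
    b = proj₂ (ends e)

  coversSet? : ∀ K A → Dec (CoversSet ends (_∈ K) A)
  coversSet? K A = any? (λ e → e ∈? K ×-dec covers? e A)

  bothEnds-at : ∀ {P e} → BothEnds P e → IsEnd ends v e → P v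
  bothEnds-at (p , _) (inj₁ refl) = p
  bothEnds-at (_ , p) (inj₂ refl) = p

  covers⇒separatedEnds : ∀ {e A} → EdgeCovers ends e A →
                         ∃₂ λ a b → IsEnd ends a e × IsEnd ends b e × Separates a b A
  covers⇒separatedEnds (inj₁ (x∈A , y∉A)) = _ , _ , inj₁ refl , inj₂ refl , x∈A , y∉A
  covers⇒separatedEnds (inj₂ (x∉A , y∈A)) = _ , _ , inj₂ refl , inj₁ refl , y∈A , x∉A

  separatedEnds⇒covers : ∀ {a b e A} → IsEnd ends a e → IsEnd ends b e → Separates a b A →
                         EdgeCovers ends e A
  separatedEnds⇒covers (inj₁ refl) (inj₁ refl) (a∈A , a∉A) = contradiction a∈A a∉A
  separatedEnds⇒covers (inj₁ refl) (inj₂ refl) (a∈A , b∉A) = inj₁ (a∈A , b∉A)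
  separatedEnds⇒covers (inj₂ refl) (inj₁ refl) (a∈A , b∉A) = inj₂ (b∉A , a∈A)
  separatedEnds⇒covers (inj₂ refl) (inj₂ refl) (a∈A , a∉A) = contradiction a∈A a∉A

  covers⇒nonempty : ∀ {e A} → EdgeCovers ends e A → Nonempty A
  covers⇒nonempty cov with covers⇒separatedEnds cov
  ... | a , _ , _ , _ , a∈A , _ = a , a∈A

  covered⇒nonempty : ∀ {S 𝓕 A} → CoversFamily ends S 𝓕 → A ∈𝓕 𝓕 → Nonempty A
  covered⇒nonempty cover A∈𝓕 with cover _ A∈𝓕
  ... | _ , _ , covers = covers⇒nonempty covers

  outside⇒¬covers : ∀ {e A} → BothEnds (_∉ A) e → ¬ EdgeCovers ends e A
  outside⇒¬covers (x∉A , _) (inj₁ (x∈A , _)) = x∉A x∈A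
  outside⇒¬covers (_ , y∉A) (inj₂ (_ , y∈A)) = y∉A y∈A

  covers-cong : ∀ {e A B} → BothEnds (λ z → z ∈ A ⇔ z ∈ B) e →
                EdgeCovers ends e A → EdgeCovers ends e B
  covers-cong {A = A} {B} agree cov with covers⇒separatedEnds cov
  ... | a , b , a∈e , b∈e , a∈A , b∉A =
    separatedEnds⇒covers a∈e b∈e
      (Equivalence.to (agree-at a∈e) a∈A , b∉A ∘ Equivalence.from (agree-at b∈e))
    where
    agree-at : IsEnd ends v _ → v ∈ A ⇔ v ∈ B
    agree-at = bothEnds-at {P = λ z → z ∈ A ⇔ z ∈ B} agree

  covers-∁ : ∀ {e A} → EdgeCovers ends e A → EdgeCovers ends e (∁ A)
  covers-∁ cov with covers⇒separatedEnds cov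
  ... | a , b , a∈e , b∈e , a∈A , b∉A = separatedEnds⇒covers b∈e a∈e (x∉p⇒x∈∁p b∉A , x∈p⇒x∉∁p a∈A)

  covers-∁⁻ : ∀ {e A} → EdgeCovers ends e (∁ A) → EdgeCovers ends e A
  covers-∁⁻ cov with covers⇒separatedEnds cov
  ... | a , b , a∈e , b∈e , a∈∁A , b∉∁A =
    separatedEnds⇒covers b∈e a∈e (x∉∁p⇒x∈p b∉∁A , x∈∁p⇒x∉p a∈∁A)

  covers∧end∈⇒¬covers-end : ∀ {e A} → IsEnd ends v e → v ∈ A → EdgeCovers ends e A →
                            ¬ EdgeCovers ends e (A - v)
  covers∧end∈⇒¬covers-end {A = A} (inj₁ refl) v∈A (inj₁ (_ , y∉A)) = outside⇒¬covers (x∉p-x , y∉A ∘ p─q⊆p A _)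
  covers∧end∈⇒¬covers-end         (inj₁ refl) v∈A (inj₂ (v∉A , _)) = contradiction v∈A v∉A
  covers∧end∈⇒¬covers-end         (inj₂ refl) v∈A (inj₁ (_ , v∉A)) = contradiction v∈A v∉A
  covers∧end∈⇒¬covers-end {A = A} (inj₂ refl) v∈A (inj₂ (x∉A , _)) = outside⇒¬covers (x∉A ∘ p─q⊆p A _ , x∉p-x)

  Closed : Subset m → Subset n → Set
  Closed J C = ∀ {e} → e ∈ J → ¬ EdgeCovers ends e C

  module _ {J : Subset m} {C : Subset n} (closed : Closed J C) where

    closed-step : ∀ {e w} → e ∈ J → IsEnd ends v e → IsEnd ends w e → v ∈ C → w ∈ C
    closed-step {w = w} e∈J v∈e w∈e v∈C =
      decidable-stable (w ∈? C) (closed e∈J ∘ separatedEnds⇒covers v∈e w∈e ∘ (v∈C ,_))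

    closed-reach : ∀ {r} → r ∈ C → Reach ends J r v → v ∈ C
    closed-reach r∈C here                    = r∈C
    closed-reach r∈C (step e r⇝v e∈J v∈e w∈e) = closed-step e∈J v∈e w∈e (closed-reach r∈C r⇝v)

    closed⇒inside⊎outside : ∀ {e} → e ∈ J → BothEnds (_∈ C) e ⊎ BothEnds (_∉ C) e
    closed⇒inside⊎outside e∈J with proj₁ (ends _) ∈? C
    ... | yes x∈C = inj₁ (x∈C , closed-step e∈J (inj₁ refl) (inj₂ refl) x∈C)
    ... | no  x∉C = inj₂ (x∉C , x∉C ∘ closed-step e∈J (inj₂ refl) (inj₁ refl))

  record Component (J : Subset m) (r : Fin n) : Set where
    field
      vertices : Subset n
      root     : r ∈ vertices
      closed   : Closed J vertices
      sound    : ∀ {v} → v ∈ vertices → Reach ends J r v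

    complete : Reach ends J r v → v ∈ vertices
    complete = closed-reach closed root

    inside⇒edge : ∀ {e} → e ∈ J → BothEnds (_∈ vertices) e → CompEdge ends J r e
    inside⇒edge e∈J (x∈C , y∈C) = e∈J , sound x∈C , sound y∈C

    incident⇒edge : ∀ {e} → e ∈ J → IsEnd ends v e → Reach ends J r v → CompEdge ends J r e
    incident⇒edge e∈J v∈e r⇝v = inside⇒edge e∈J (at (inj₁ refl) , at (inj₂ refl))
      where
      at : ∀ {w} → IsEnd ends w _ → w ∈ vertices
      at w∈e = closed-step closed e∈J v∈e w∈e (complete r⇝v)

  component : (J : Subset m) (r : Fin n) → Component J r
  component J r = grow (⊃-wellFounded ⁅ r ⁆) (x∈⁅x⁆ r) λ v∈⁅r⁆ →
    subst (Reach ends J r) (sym (x∈⁅y⁆⇒x≡y r v∈⁅r⁆)) here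
    where
    grow : ∀ {S} → Acc _⊃_ S → r ∈ S → (∀ {v} → v ∈ S → Reach ends J r v) → Component J r
    grow {S} (acc rec) r∈S sound with any? (λ e → e ∈? J ×-dec covers? e S)
    ... | no ∄e = record
      { vertices = S ; root = r∈S ; closed = λ e∈J cov → ∄e (_ , e∈J , cov) ; sound = sound }
    ... | yes (e , e∈J , cov) with covers⇒separatedEnds cov
    ...   | a , b , a∈e , b∈e , a∈S , b∉S = grow (rec S⊂S+b) (p⊆p∪q ⁅ b ⁆ r∈S) sound+b
      where
      S⊂S+b : S ⊂ S ∪ ⁅ b ⁆
      S⊂S+b = p⊆p∪q ⁅ b ⁆ , b , q⊆p∪q S ⁅ b ⁆ (x∈⁅x⁆ b) , b∉S
      sound+b : ∀ {v} → v ∈ S ∪ ⁅ b ⁆ → Reach ends J r v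
      sound+b v∈S+b with x∈p∪q⁻ S ⁅ b ⁆ v∈S+b
      ... | inj₁ v∈S  = sound v∈S
      ... | inj₂ v∈⁅b⁆ rewrite x∈⁅y⁆⇒x≡y b v∈⁅b⁆ = step e (sound a∈S) e∈J a∈e b∈e

  Witness : Family {n} → Subset m → Fin m → Subset n → Set
  Witness 𝓕 J e A = A ∈𝓕 𝓕 × EdgeCovers ends e A × (∀ {f} → f ∈ J → EdgeCovers ends f A → f ≡ e)

  minimalCover⇒witness : ∀ {𝓕 J e} → MinimalCover ends 𝓕 J → e ∈ J → ∃[ A ] Witness 𝓕 J e A
  minimalCover⇒witness {𝓕} {J} {e} (cover , minimal) e∈J
    with anySubset? (λ A → (𝓕 ∈𝓕?) A ×-dec ¬? (coversSet? (J - e) A))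
  ... | no ∄A = contradiction (x∈p⇒p-x⊂p e∈J) (⊂-irref (minimal (J - e) (p─q⊆p J ⁅ e ⁆) J-e-covers))
    where
    J-e-covers : CoversFamily ends (_∈ J - e) 𝓕
    J-e-covers A A∈𝓕 = decidable-stable (coversSet? (J - e) A) λ ¬covered → ∄A (A , A∈𝓕 , ¬covered)
  ... | yes (A , A∈𝓕 , ¬covered) = A , A∈𝓕 , e-covers , only
    where
    only : ∀ {f} → f ∈ J → EdgeCovers ends f A → f ≡ e
    only {f} f∈J cov = decidable-stable (f ≟ e) λ f≢e → ¬covered (f , x∈p∧x≢y⇒x∈p-y f∈J f≢e , cov)
    e-covers : EdgeCovers ends e A
    e-covers with cover A A∈𝓕
    ... | f , f∈J , cov with only f∈J cov
    ...   | refl = cov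

  witness-∁ : ∀ {𝓕 J e A} → (∀ A → A ∈𝓕 𝓕 → ∁ A ∈𝓕 𝓕) → Witness 𝓕 J e A → Witness 𝓕 J e (∁ A)
  witness-∁ {A = A} ∁-closed (A∈𝓕 , e-covers , only) =
    ∁-closed A A∈𝓕 , covers-∁ e-covers , λ f∈J → only f∈J ∘ covers-∁⁻

  witness∋ : ∀ {𝓕 J e} → (∀ A → A ∈𝓕 𝓕 → ∁ A ∈𝓕 𝓕) → MinimalCover ends 𝓕 J → e ∈ J →
             ∀ v → ∃[ A ] (Witness 𝓕 J e A × v ∈ A)
  witness∋ ∁-closed minimalCover e∈J v with minimalCover⇒witness minimalCover e∈J
  ... | A , w with v ∈? A
  ...   | yes v∈A = A , w , v∈A
  ...   | no  v∉A = ∁ A , witness-∁ ∁-closed w , x∉p⇒x∈∁p v∉A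

  module _ {𝓕 : Family {n}} (dc : DisjointnessCompliable 𝓕) where

    halo⇒∩∈𝓕 : ∀ {t A C} → CoresSingletons 𝓕 → t ∈ C → InHalo 𝓕 t A → (A ∩ C) ∈𝓕 𝓕
    halo⇒∩∈𝓕 {A = A} {C} cs t∈C (A∈𝓕 , _ , only-t) with dc (A ∩ C) A (p∩q⊆p A C) A∈𝓕
    ... | inj₁ A∩C∈𝓕 = A∩C∈𝓕
    ... | inj₂ A∖C∈𝓕 with terminal∈ 𝓕 cs A∖C∈𝓕
    ...   | s , s-terminal , s∈A∖C with only-t s s-terminal (p─q⊆p A (A ∩ C) s∈A∖C)
    ...     | refl = contradiction s∈A∖C (x∈q⇒x∉p─p∩q t∈C)

    module _ {J : Subset m} (cover : CoversFamily ends (_∈ J) 𝓕) where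

      ¬covered-─⇒∈𝓕 : ∀ {A′ A} → A′ ⊆ A → A ∈𝓕 𝓕 →
                      (∀ {f} → f ∈ J → ¬ EdgeCovers ends f (A ─ A′)) → A′ ∈𝓕 𝓕
      ¬covered-─⇒∈𝓕 {A′} {A} A′⊆A A∈𝓕 ¬covered with dc A′ A A′⊆A A∈𝓕
      ... | inj₁ A′∈𝓕 = A′∈𝓕
      ... | inj₂ A─A′∈𝓕 with cover _ A─A′∈𝓕
      ...   | f , f∈J , f-covers = contradiction f-covers (¬covered f∈J)

      witness-leaf⇒⁅v⁆∈𝓕 : ∀ {e A} → Witness 𝓕 J e A → v ∈ A → IsEnd ends v e →
                            (∀ {f} → f ∈ J → IsEnd ends v f → f ≡ e) → ⁅ v ⁆ ∈𝓕 𝓕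
      witness-leaf⇒⁅v⁆∈𝓕 {v = v} {A = A} (A∈𝓕 , e-covers , only) v∈A v∈e only-at-v =
        ¬covered-─⇒∈𝓕 (x∈p⇒⁅x⁆⊆p v∈A) A∈𝓕 ¬covers-A-v
        where
        ¬covers-A-v : ∀ {f} → f ∈ J → ¬ EdgeCovers ends f (A - v)
        ¬covers-A-v {f} f∈J f-covers with isEnd? v f
        ... | yes v∈f with only-at-v f∈J v∈f
        ...   | refl = covers∧end∈⇒¬covers-end v∈e v∈A e-covers f-covers
        ¬covers-A-v {f} f∈J f-covers | no v∉f
          with only f∈J (covers-cong (x≢y⇒[x∈p-y⇔x∈p] (v∉f ∘ inj₁) , x≢y⇒[x∈p-y⇔x∈p] (v∉f ∘ inj₂))
                                     f-covers)
        ...   | refl = v∉f v∈e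

      module _ {C : Subset n} (closed : Closed J C) where

        witness⇒∩∈𝓕 : ∀ {e A} → BothEnds (_∈ C) e → Witness 𝓕 J e A → (A ∩ C) ∈𝓕 𝓕
        witness⇒∩∈𝓕 {A = A} (e₁∈C , _) (A∈𝓕 , _ , only) = ¬covered-─⇒∈𝓕 (p∩q⊆p A C) A∈𝓕 ¬covers-A∖C
          where
          ¬covers-A∖C : ∀ {f} → f ∈ J → ¬ EdgeCovers ends f (A ─ (A ∩ C))
          ¬covers-A∖C f∈J f-covers with closed⇒inside⊎outside closed f∈J
          ... | inj₁ (x∈C , y∈C) = outside⇒¬covers (x∈q⇒x∉p─p∩q x∈C , x∈q⇒x∉p─p∩q y∈C) f-covers
          ... | inj₂ (x∉C , y∉C)
            with only f∈J (covers-cong (x∉q⇒[x∈p─p∩q⇔x∈p] x∉C , x∉q⇒[x∈p─p∩q⇔x∈p] y∉C) f-covers)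
          ...   | refl = x∉C e₁∈C

        ∩∈𝓕⇒inside-cover : ∀ {A} → (A ∩ C) ∈𝓕 𝓕 →
                           ∃[ f ] (f ∈ J × BothEnds (_∈ C) f × EdgeCovers ends f A)
        ∩∈𝓕⇒inside-cover {A} A∩C∈𝓕 with cover _ A∩C∈𝓕
        ... | f , f∈J , f-covers with closed⇒inside⊎outside closed f∈J
        ...   | inj₁ (x∈C , y∈C) =
          f , f∈J , (x∈C , y∈C) , covers-cong (x∈q⇒[x∈p∩q⇔x∈p] x∈C , x∈q⇒[x∈p∩q⇔x∈p] y∈C) f-covers
        ...   | inj₂ (x∉C , y∉C) =
          contradiction f-covers (outside⇒¬covers (x∉C ∘ p∩q⊆q A C , y∉C ∘ p∩q⊆q A C))

module MinimalCoverComponent {𝓕 : Family {n}} {J : Subset m} (ends : Fin m → Fin n × Fin n) (r : Fin n)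
  (dc : DisjointnessCompliable 𝓕) (cs : CoresSingletons 𝓕) (minimalCover : MinimalCover ends 𝓕 J) where

  open Component (component ends J r)

  cover : CoversFamily ends (_∈ J) 𝓕
  cover = proj₁ minimalCover

  edge-witness⇒terminal : ∀ {e A} → CompEdge ends J r e → Witness ends 𝓕 J e A →
                          ∃[ t ] (Terminal 𝓕 t × t ∈ A × CompVertex ends J r t)
  edge-witness⇒terminal (_ , r⇝x , r⇝y) w
    with terminal∈ 𝓕 cs (witness⇒∩∈𝓕 ends dc cover closed (complete r⇝x , complete r⇝y) w)
  ... | t , t-terminal , t∈A∩C = t , t-terminal , p∩q⊆p _ _ t∈A∩C , sound (p∩q⊆q _ _ t∈A∩C)

  component-terminal : CompHasEdge ends J r → ∃[ t ] (Terminal 𝓕 t × CompVertex ends J r t)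
  component-terminal (e , e-edge@(e∈J , _)) with minimalCover⇒witness ends minimalCover e∈J
  ... | A , w with edge-witness⇒terminal e-edge w
  ...   | t , t-terminal , _ , r⇝t = t , t-terminal , r⇝t

  sole-terminal⇒restrictedHaloCover : ∀ {t} → CompVertex ends J r t →
    (∀ s → Terminal 𝓕 s → CompVertex ends J r s → s ≡ t) → RestrictedHaloCover ends 𝓕 t (CompEdge ends J r)
  sole-terminal⇒restrictedHaloCover {t} r⇝t sole = halo-covered , no-other-terminal
    where
    halo-covered : ∀ A → InHalo 𝓕 t A → CoversSet ends (CompEdge ends J r) A
    halo-covered A A-halo
      with ∩∈𝓕⇒inside-cover ends dc cover closed (halo⇒∩∈𝓕 ends dc cs (complete r⇝t) A-halo)
    ... | f , f∈J , f-inside , f-covers = f , inside⇒edge f∈J f-inside , f-covers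
    no-other-terminal : ∀ e → CompEdge ends J r e → ∀ x → IsEnd ends x e → Terminal 𝓕 x → x ≡ t
    no-other-terminal _ (_ , r⇝x , _) x (inj₁ refl) x-terminal = sole x x-terminal r⇝x
    no-other-terminal _ (_ , _ , r⇝y) y (inj₂ refl) y-terminal = sole y y-terminal r⇝y

  leaf-terminal : Proper 𝓕 → ∀ {v} → IsLeaf ends J r v → Terminal 𝓕 v
  leaf-terminal (_ , ∁-closed) {v} (r⇝v , e , (e∈J , _) , v∈e , only-e)
    with witness∋ ends ∁-closed minimalCover e∈J v
  ... | A , w , v∈A = singleton⇒terminal 𝓕 (covered⇒nonempty ends cover)
                        (witness-leaf⇒⁅v⁆∈𝓕 ends dc cover w v∈A v∈e only-at-v)
    where
    only-at-v : ∀ {f} → f ∈ J → IsEnd ends v f → f ≡ e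
    only-at-v f∈J v∈f = only-e _ (incident⇒edge f∈J v∈f r⇝v) v∈f

  two-terminals : Proper 𝓕 → CompHasEdge ends J r →
    ∃[ t₁ ] ∃[ t₂ ] (Terminal 𝓕 t₁ × Terminal 𝓕 t₂ × ¬ (t₁ ≡ t₂)
                     × CompVertex ends J r t₁ × CompVertex ends J r t₂)
  two-terminals (_ , ∁-closed) (e , e-edge@(e∈J , _)) with minimalCover⇒witness ends minimalCover e∈J
  ... | A , w
    with edge-witness⇒terminal e-edge w | edge-witness⇒terminal e-edge (witness-∁ ends ∁-closed w)
  ...   | t₁ , t₁-terminal , t₁∈A , r⇝t₁ | t₂ , t₂-terminal , t₂∈∁A , r⇝t₂ =
    t₁ , t₂ , t₁-terminal , t₂-terminal , (λ { refl → x∈∁p⇒x∉p t₂∈∁A t₁∈A }) , r⇝t₁ , r⇝t₂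

lemma11 : ∀ {n m : ℕ} (ends : Fin m → Fin n × Fin n) (𝓕 : Family {n}) (J : Subset m) (r : Fin n)
    → DisjointnessCompliable 𝓕
    → CoresSingletons 𝓕
    → MinimalCover ends 𝓕 J
    → CompHasEdge ends J r
    → (∃[ t ] (Terminal 𝓕 t × CompVertex ends J r t))
      × (∀ (t : Fin n) → Terminal 𝓕 t → CompVertex ends J r t
           → (∀ (s : Fin n) → Terminal 𝓕 s → CompVertex ends J r s → s ≡ t)
           → RestrictedHaloCover ends 𝓕 t (CompEdge ends J r))
      × (Proper 𝓕
           → (∀ (v : Fin n) → IsLeaf ends J r v → Terminal 𝓕 v)
             × (∃[ t₁ ] ∃[ t₂ ] (Terminal 𝓕 t₁ × Terminal 𝓕 t₂ × ¬ (t₁ ≡ t₂)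
                 × CompVertex ends J r t₁ × CompVertex ends J r t₂)))
lemma11 ends 𝓕 J r dc cs minimalCover has-edge =
    component-terminal has-edge
  , (λ _ _ r⇝t sole → sole-terminal⇒restrictedHaloCover r⇝t sole)
  , λ proper → (λ _ → leaf-terminal proper) , two-terminals proper has-edge
  where open MinimalCoverComponent ends r dc cs minimalCover
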